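{- Let $n\ge d>0$ be integers and let $x$ be an indeterminate. Define $v_0=2$, $v_1=x-2$ and $v_{k+1}=(x-2)v_k-v_{k-1}$ for $k\ge1$. Then $$d\sum_{k=1}^{n}\binom{2k}{k+d}\frac{x^{n-k}}{k}=\sum_{k=0}^{n-d}\binom{2n}{n+d+k}v_k-\binom{2n}{n+d}.$$ -}

module Defs where

open import Data.Nat as ℕ using (ℕ; zero; suc; _∸_)
open import Data.Nat.Combinatorics using (_C_)
open import Data.Integer using (+_)
open import Data.Rational as ℚ using (ℚ; _/_; 0ℚ)

-- A polynomial in one indeterminate x over ℚ, given by its coefficient
-- sequence: p i is the coefficient of x^i (finite support is not needed
-- for the identity; all polynomials below are built from finitely many
-- monomials).
Poly : Set
Poly = ℕ → ℚ

⟦_⟧ : ℕ → ℚ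
⟦ m ⟧ = (+ m) / 1

_⊕_ : Poly → Poly → Poly
(p ⊕ q) i = p i ℚ.+ q i

_⊖_ : Poly → Poly → Poly
(p ⊖ q) i = p i ℚ.- q i

_·_ : ℚ → Poly → Poly
(c · p) i = c ℚ.* p i

0P : Poly
0P _ = 0ℚ

mono : ℕ → ℚ → Poly
mono zero    c zero    = c
mono zero    c (suc i) = 0ℚ
mono (suc m) c zero    = 0ℚ
mono (suc m) c (suc i) = mono m c i

const : ℚ → Poly
const = mono 0

xMul : Poly → Poly
xMul p zero    = 0ℚ
xMul p (suc i) = p i

xm2Mul : Poly → Poly
xm2Mul p = xMul p ⊖ (⟦ 2 ⟧ · p)

v : ℕ → Poly
v zero = const ⟦ 2 ⟧
v (suc zero) = xm2Mul (const ⟦ 1 ⟧)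
v (suc (suc k)) = xm2Mul (v (suc k)) ⊖ v k

sumBelow : ℕ → (ℕ → Poly) → Poly
sumBelow zero    f = 0P
sumBelow (suc m) f = sumBelow m f ⊕ f m

-- d * Σ_{k=1}^{n} C(2k, k+d) x^{n-k} / k   (k = suc j, j = 0..n-1)
LHS : ℕ → ℕ → Poly
LHS n d = ⟦ d ⟧ · sumBelow n (λ j →
  mono (n ∸ suc j) ((+ ((2 ℕ.* suc j) C (suc j ℕ.+ d))) / suc j))

RHS : ℕ → ℕ → Poly
RHS n d = sumBelow (suc (n ∸ d)) (λ k → ⟦ (2 ℕ.* n) C (n ℕ.+ d ℕ.+ k) ⟧ · v k)
          ⊖ const ⟦ (2 ℕ.* n) C (n ℕ.+ d) ⟧

module Submission where

open import Defs
open import Data.Nat using (ℕ; _<_; _≤_)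
open import Relation.Binary.PropositionalEquality using (_≡_)

open import Data.Nat as Nat using (zero; suc; _∸_; s≤s)
import Data.Nat.Properties as ℕP
open import Data.Nat.Combinatorics using (_C_; k>n⇒nCk≡0; nC1≡n; nCk+nC[k+1]≡[n+1]C[k+1])
open import Data.Integer as ℤ using (+_)
import Data.Integer.Properties as ℤP
open import Data.Rational as Q using (ℚ; 0ℚ; 1ℚ; toℚᵘ)
import Data.Rational.Properties as ℚP
open import Data.Rational.Unnormalised as ℚᵘ using (mkℚᵘ; *≡*) renaming (_≃_ to _≃ᵘ_)
import Data.Rational.Unnormalised.Properties as ℚᵘP
open import Relation.Binary.PropositionalEquality
  using (refl; sym; trans; cong; cong₂; _≗_; _→-setoid_; module ≡-Reasoning)
open import Relation.Nullary.Decidable using (dec⇒maybe)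
open import Level using (0ℓ)
import Tactic.RingSolver as RingSolver
open import Tactic.RingSolver.Core.AlmostCommutativeRing using (AlmostCommutativeRing; fromCommutativeRing)
import Data.Nat.Tactic.RingSolver as ℕSolver
import Data.Integer.Tactic.RingSolver as ℤSolver

-- Fix d ≥ 1 and write L_n, R_n for the two sides of the identity.  The
-- proof is an induction on n showing that both sides obey the same
-- recurrence  P_{n+1} = x·P_n + (C(2n, n+d-1) - C(2n, n+d+1)),  with L_0 = R_0 = 0.
--
--  * Left side: L_n = d·Σ_j c_j x^{n-1-j} is a Horner sum, so
--    L_{n+1} = x·L_n + d·c_n, and d·c_n = d·C(2n+2, n+1+d)/(n+1) equals
--    C(2n, n+d-1) - C(2n, n+d+1) by the absorption identity for binomials.
--  * Right side: since x·v_k = v_{k+1} + 2v_k + v_{k-1} (with v_{-1} := v_1),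
--    multiplication by x acts on the coefficient sequence of Σ a_k v_k as
--    the operator a ↦ a_{k-1} + 2a_k + a_{k+1}, which maps the row
--    C(2n, n+d+k) to the row C(2n+2, n+1+d+k) by Pascal's rule twice.

toℚᵘ-⟦⟧ : ∀ m → toℚᵘ ⟦ m ⟧ ≃ᵘ mkℚᵘ (+ m) 0
toℚᵘ-⟦⟧ m = ℚP.toℚᵘ-fromℚᵘ (mkℚᵘ (+ m) 0)

⟦⟧-+ : ∀ a b → ⟦ a Nat.+ b ⟧ ≡ ⟦ a ⟧ Q.+ ⟦ b ⟧
⟦⟧-+ a b = ℚP.toℚᵘ-injective (begin
  toℚᵘ ⟦ a Nat.+ b ⟧                ≈⟨ toℚᵘ-⟦⟧ (a Nat.+ b) ⟩
  mkℚᵘ (+ (a Nat.+ b)) 0            ≈⟨ *≡* (trans (cong (ℤ._* + 1) (ℤP.pos-+ a b)) (cross (+ a) (+ b))) ⟩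
  mkℚᵘ (+ a) 0 ℚᵘ.+ mkℚᵘ (+ b) 0    ≈⟨ ℚᵘP.+-cong (toℚᵘ-⟦⟧ a) (toℚᵘ-⟦⟧ b) ⟨
  toℚᵘ ⟦ a ⟧ ℚᵘ.+ toℚᵘ ⟦ b ⟧         ≈⟨ ℚP.toℚᵘ-homo-+ ⟦ a ⟧ ⟦ b ⟧ ⟨
  toℚᵘ (⟦ a ⟧ Q.+ ⟦ b ⟧)            ∎)
  where
  open import Relation.Binary.Reasoning.Setoid ℚᵘP.≃-setoid
  cross : ∀ x y → (x ℤ.+ y) ℤ.* + 1 ≡ (x ℤ.* + 1 ℤ.+ y ℤ.* + 1) ℤ.* + 1
  cross = ℤSolver.solve-∀

⟦⟧-* : ∀ a b → ⟦ a Nat.* b ⟧ ≡ ⟦ a ⟧ Q.* ⟦ b ⟧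
⟦⟧-* a b = ℚP.toℚᵘ-injective (begin
  toℚᵘ ⟦ a Nat.* b ⟧                ≈⟨ toℚᵘ-⟦⟧ (a Nat.* b) ⟩
  mkℚᵘ (+ (a Nat.* b)) 0            ≈⟨ *≡* (cong (ℤ._* + 1) (ℤP.pos-* a b)) ⟩
  mkℚᵘ (+ a) 0 ℚᵘ.* mkℚᵘ (+ b) 0    ≈⟨ ℚᵘP.*-cong (toℚᵘ-⟦⟧ a) (toℚᵘ-⟦⟧ b) ⟨
  toℚᵘ ⟦ a ⟧ ℚᵘ.* toℚᵘ ⟦ b ⟧         ≈⟨ ℚP.toℚᵘ-homo-* ⟦ a ⟧ ⟦ b ⟧ ⟨
  toℚᵘ (⟦ a ⟧ Q.* ⟦ b ⟧)            ∎)
  where open import Relation.Binary.Reasoning.Setoid ℚᵘP.≃-setoid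

quotient-law : ∀ n d D a b → suc n Nat.* a ≡ suc n Nat.* b Nat.+ d Nat.* D →
               ⟦ d ⟧ Q.* ((+ D) Q./ suc n) ≡ ⟦ a ⟧ Q.- ⟦ b ⟧
quotient-law n d D a b hyp = ℚP.toℚᵘ-injective (begin
  toℚᵘ (⟦ d ⟧ Q.* ((+ D) Q./ suc n))        ≈⟨ ℚP.toℚᵘ-homo-* ⟦ d ⟧ _ ⟩
  toℚᵘ ⟦ d ⟧ ℚᵘ.* toℚᵘ ((+ D) Q./ suc n)    ≈⟨ ℚᵘP.*-cong (toℚᵘ-⟦⟧ d) (ℚP.toℚᵘ-fromℚᵘ (mkℚᵘ (+ D) n)) ⟩
  mkℚᵘ (+ d) 0 ℚᵘ.* mkℚᵘ (+ D) n            ≈⟨ *≡* cross-multiplied ⟩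
  mkℚᵘ (+ a) 0 ℚᵘ.- mkℚᵘ (+ b) 0            ≈⟨ ℚᵘP.+-cong (toℚᵘ-⟦⟧ a) (ℚᵘP.-‿cong (toℚᵘ-⟦⟧ b)) ⟨
  toℚᵘ ⟦ a ⟧ ℚᵘ.- toℚᵘ ⟦ b ⟧                ≈⟨ ℚᵘP.+-congʳ (toℚᵘ ⟦ a ⟧) (ℚP.toℚᵘ-homo‿- ⟦ b ⟧) ⟨
  toℚᵘ ⟦ a ⟧ ℚᵘ.+ toℚᵘ (Q.- ⟦ b ⟧)          ≈⟨ ℚP.toℚᵘ-homo-+ ⟦ a ⟧ _ ⟨
  toℚᵘ (⟦ a ⟧ Q.- ⟦ b ⟧)                    ∎)
  where
  open import Relation.Binary.Reasoning.Setoid ℚᵘP.≃-setoid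
  open ℤ using (ℤ; _+_; _*_; _-_; -_)
  s : ℤ
  s = + suc n
  hypℤ : s * + a ≡ s * + b + + d * + D
  hypℤ = trans (sym (ℤP.pos-* (suc n) a))
           (trans (cong +_ hyp) (trans (ℤP.pos-+ (suc n Nat.* b) (d Nat.* D))
             (cong₂ _+_ (ℤP.pos-* (suc n) b) (ℤP.pos-* d D))))
  split : ∀ s b P → P * (+ 1 * + 1) ≡ (s * b + P) - s * b
  split = ℤSolver.solve-∀
  merge : ∀ s a b → s * a - s * b ≡ (a * + 1 + (- b) * + 1) * (+ 1 * s)
  merge = ℤSolver.solve-∀
  cross-multiplied : (+ d * + D) * (+ 1 * + 1) ≡ (+ a * + 1 + (- + b) * + 1) * (+ 1 * s)
  cross-multiplied = trans (split s (+ b) (+ d * + D))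
    (trans (cong (_- s * + b) (sym hypℤ)) (merge s (+ a) (+ b)))

central : ℕ → ℕ → ℕ
central n j = (2 Nat.* n) C (j Nat.+ n)

module _ where
  open Nat using (_+_; _*_)
  open ≡-Reasoning

  pascal : ∀ m k → m C k + m C suc k ≡ suc m C suc k
  pascal = nCk+nC[k+1]≡[n+1]C[k+1]

  -- Absorption, (k+1)·C(m,k+1) = (m-k)·C(m,k), written without subtraction.
  absorption : ∀ m k → suc k * (m C suc k) + k * (m C k) ≡ m * (m C k)
  absorption m       zero    = trans (cong (λ c → 1 * c + 0) (nC1≡n m)) (unit m)
    where
    unit : ∀ m → 1 * m + 0 ≡ m * 1
    unit = ℕSolver.solve-∀
  absorption zero    (suc k) = vanish k
    where
    vanish : ∀ k → suc (suc k) * 0 + suc k * 0 ≡ 0 * 0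
    vanish = ℕSolver.solve-∀
  absorption (suc m) (suc k) = begin
    suc (suc k) * (suc m C suc (suc k)) + suc k * (suc m C suc k)
      ≡⟨ cong₂ (λ z y → suc (suc k) * z + suc k * y) (sym (pascal m (suc k))) (sym (pascal m k)) ⟩
    suc (suc k) * (Y + Z) + suc k * (X + Y)
      ≡⟨ regroup k X Y Z ⟩
    (suc (suc k) * Z + suc k * Y) + (suc k * Y + k * X) + X + Y
      ≡⟨ cong₂ (λ p q → p + q + X + Y) (absorption m (suc k)) (absorption m k) ⟩
    m * Y + m * X + X + Y
      ≡⟨ collect m X Y ⟩
    suc m * (X + Y)
      ≡⟨ cong (suc m *_) (pascal m k) ⟩
    suc m * (suc m C suc k)
      ∎
    where
    X Y Z : ℕ
    X = m C k
    Y = m C suc k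
    Z = m C suc (suc k)
    regroup : ∀ k X Y Z → suc (suc k) * (Y + Z) + suc k * (X + Y)
                          ≡ (suc (suc k) * Z + suc k * Y) + (suc k * Y + k * X) + X + Y
    regroup = ℕSolver.solve-∀
    collect : ∀ m X Y → m * Y + m * X + X + Y ≡ suc m * (X + Y)
    collect = ℕSolver.solve-∀

  pascal² : ∀ m k → m C k + 2 * (m C suc k) + m C suc (suc k) ≡ suc (suc m) C suc (suc k)
  pascal² m k = begin
    m C k + 2 * (m C suc k) + m C suc (suc k)
      ≡⟨ double (m C k) (m C suc k) (m C suc (suc k)) ⟩
    (m C k + m C suc k) + (m C suc k + m C suc (suc k))
      ≡⟨ cong₂ _+_ (pascal m k) (pascal m (suc k)) ⟩
    suc m C suc k + suc m C suc (suc k)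
      ≡⟨ pascal (suc m) (suc k) ⟩
    suc (suc m) C suc (suc k)
      ∎
    where
    double : ∀ x y z → x + 2 * y + z ≡ (x + y) + (y + z)
    double = ℕSolver.solve-∀

  central-pascal : ∀ n j → central n j + 2 * central n (suc j) + central n (suc (suc j))
                           ≡ central (suc n) (suc j)
  central-pascal n j = trans (pascal² (2 * n) (j + n))
    (sym (cong₂ _C_ (ℕP.*-suc 2 n) (ℕP.+-suc (suc j) n)))

  central-vanish : ∀ {n j} → n < j → central n j ≡ 0
  central-vanish {n} n<j = k>n⇒nCk≡0
    (ℕP.≤-<-trans (ℕP.≤-reflexive (cong (λ m → n + m) (ℕP.+-identityʳ n))) (ℕP.+-monoˡ-< n n<j))

  -- The linear algebra behind central-quotient: the two absorption relations
  -- between am, a₀, a₁ determine (n+1)·(am - a₁).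
  eliminate : ∀ n e am a₀ a₁ →
              suc (e + n) * a₀ + (e + n) * am ≡ (2 * n) * am →
              suc (suc (e + n)) * a₁ + suc (e + n) * a₀ ≡ (2 * n) * a₀ →
              suc n * am ≡ suc n * a₁ + suc e * (am + 2 * a₀ + a₁)
  eliminate n e am a₀ a₁ rel₁ rel₂ = ℕP.+-cancelˡ-≡ (lhs₁ + lhs₂) _ _ (begin
    (lhs₁ + lhs₂) + suc n * am
      ≡⟨ combine n e am a₀ a₁ ⟩
    (2 * n) * am + (2 * n) * a₀ + rhs
      ≡⟨ cong₂ (λ p q → p + q + rhs) rel₁ rel₂ ⟨
    (lhs₁ + lhs₂) + rhs
      ∎)
    where
    lhs₁ lhs₂ rhs : ℕ
    lhs₁ = suc (e + n) * a₀ + (e + n) * am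
    lhs₂ = suc (suc (e + n)) * a₁ + suc (e + n) * a₀
    rhs  = suc n * a₁ + suc e * (am + 2 * a₀ + a₁)
    combine : ∀ n e am a₀ a₁ →
      ((suc (e + n) * a₀ + (e + n) * am) + (suc (suc (e + n)) * a₁ + suc (e + n) * a₀)) + suc n * am
      ≡ (2 * n) * am + (2 * n) * a₀ + (suc n * a₁ + suc e * (am + 2 * a₀ + a₁))
    combine = ℕSolver.solve-∀

  central-quotient : ∀ n e → suc n * central n e
                             ≡ suc n * central n (suc (suc e)) + suc e * central (suc n) (suc e)
  central-quotient n e = trans
    (eliminate n e (central n e) (central n (suc e)) (central n (suc (suc e)))
       (absorption (2 * n) (e + n)) (absorption (2 * n) (suc (e + n))))
    (cong (λ c → suc n * central n (suc (suc e)) + suc e * c) (central-pascal n e))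

ℚ-ring : AlmostCommutativeRing 0ℓ 0ℓ
ℚ-ring = fromCommutativeRing ℚP.+-*-commutativeRing (λ x → dec⇒maybe (0ℚ ℚP.≟ x))

open Q using (_+_; _*_; _-_)

𝟙 : Poly
𝟙 = const 1ℚ

const-scale : ∀ c → const c ≗ c · 𝟙
const-scale c zero    = sym (ℚP.*-identityʳ c)
const-scale c (suc i) = sym (ℚP.*-zeroʳ c)

xMul-0P : xMul 0P ≗ 0P
xMul-0P zero    = refl
xMul-0P (suc i) = refl

xMul-⊕ : ∀ p q → xMul (p ⊕ q) ≗ xMul p ⊕ xMul q
xMul-⊕ p q zero    = sym (ℚP.+-identityʳ 0ℚ)
xMul-⊕ p q (suc i) = refl

xMul-⊖ : ∀ p q → xMul (p ⊖ q) ≗ xMul p ⊖ xMul q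
xMul-⊖ p q zero    = sym (ℚP.+-inverseʳ 0ℚ)
xMul-⊖ p q (suc i) = refl

xMul-· : ∀ c p → xMul (c · p) ≗ c · xMul p
xMul-· c p zero    = sym (ℚP.*-zeroʳ c)
xMul-· c p (suc i) = refl

xMul-cong : ∀ {p q} → p ≗ q → xMul p ≗ xMul q
xMul-cong p≗q zero    = refl
xMul-cong p≗q (suc i) = p≗q i

xMul-mono : ∀ m c → xMul (mono m c) ≗ mono (suc m) c
xMul-mono m c zero    = refl
xMul-mono m c (suc i) = refl

sum-cong : ∀ N {f g : ℕ → Poly} → (∀ k → k < N → f k ≗ g k) → sumBelow N f ≗ sumBelow N g
sum-cong zero    f≗g i = refl
sum-cong (suc N) f≗g i =
  cong₂ _+_ (sum-cong N (λ k k<N → f≗g k (ℕP.m<n⇒m<1+n k<N)) i) (f≗g N (ℕP.n<1+n N) i)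

xMul-sum : ∀ N f → xMul (sumBelow N f) ≗ sumBelow N (λ k → xMul (f k))
xMul-sum zero    f i = xMul-0P i
xMul-sum (suc N) f i =
  trans (xMul-⊕ (sumBelow N f) (f N) i) (cong (_+ xMul (f N) i) (xMul-sum N f i))

sum-stable : ∀ {T} (f : ℕ → Poly) → (∀ k → T ≤ k → f k ≗ 0P) →
             ∀ {M} → T ≤ M → sumBelow M f ≗ sumBelow T f
sum-stable {T} f vanish T≤M = go (ℕP.≤⇒≤′ T≤M)
  where
  go : ∀ {M} → T Nat.≤′ M → sumBelow M f ≗ sumBelow T f
  go Nat.≤′-refl                i = refl
  go (Nat.≤′-step {M} T≤′M) i =
    trans (cong₂ _+_ (go T≤′M i) (vanish M (ℕP.≤′⇒≤ T≤′M) i)) (ℚP.+-identityʳ _)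

prev : {A : Set} → A → (ℕ → A) → ℕ → A
prev x₋ f zero    = x₋
prev x₋ f (suc k) = f k

-- x·v_k = v_{k+1} + 2v_k + v_{k-1}, where v_{-1} := v_1 (so x·v_0 = 2x = 2v_1 + 2v_0).
x-v : ∀ k → xMul (v k) ≗ (v (suc k) ⊕ (⟦ 2 ⟧ · v k)) ⊕ prev (v 1) v k
x-v zero    zero          = refl
x-v zero    (suc zero)    = refl
x-v zero    (suc (suc i)) = refl
x-v (suc k) i = unfold (xMul (v (suc k)) i) (v (suc k) i) (v k i)
  where
  unfold : ∀ X Y Z → X ≡ (((X - ⟦ 2 ⟧ * Y) - Z) + ⟦ 2 ⟧ * Y) + Z
  unfold = RingSolver.solve-∀ ℚ-ring

pascal-op : ℚ → (ℕ → ℚ) → ℕ → ℚ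
pascal-op a₋ a k = prev a₋ a k + ⟦ 2 ⟧ * a k + a (suc k)

vSum : ℕ → (ℕ → ℚ) → Poly
vSum N a = sumBelow N (λ k → a k · v k)

-- x·Σ_{k<N} a_k v_k re-expanded in the v_k: Pascal coefficients plus two boundary terms,
-- one at k = 0 (from v_{-1} = v_1 and the fictitious a₋) and one at k = N.
x-vSum : ∀ a₋ a N → xMul (vSum N a) ≗
  vSum N (pascal-op a₋ a) ⊕ (((a 0 · v 1) ⊖ (a₋ · v 0)) ⊕ ((prev a₋ a N · v N) ⊖ (a N · prev (v 1) v N)))
x-vSum a₋ a zero i = trans (xMul-0P i) (cancel (a 0 * v 1 i) (a₋ * v 0 i))
  where
  cancel : ∀ p q → 0ℚ ≡ 0ℚ + ((p - q) + (q - p))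
  cancel = RingSolver.solve-∀ ℚ-ring
x-vSum a₋ a (suc N) i = begin
  xMul (vSum N a ⊕ (a N · v N)) i
    ≡⟨ xMul-⊕ (vSum N a) (a N · v N) i ⟩
  xMul (vSum N a) i + xMul (a N · v N) i
    ≡⟨ cong₂ _+_ (x-vSum a₋ a N i) (trans (xMul-· (a N) (v N) i) (cong (a N *_) (x-v N i))) ⟩
  (S + (B + (prev a₋ a N * v N i - a N * prev (v 1) v N i)))
    + a N * ((v (suc N) i + ⟦ 2 ⟧ * v N i) + prev (v 1) v N i)
    ≡⟨ regroup S B (prev a₋ a N) (a N) (a (suc N)) (v N i) (v (suc N) i) (prev (v 1) v N i) ⟩
  (S + pascal-op a₋ a N * v N i) + (B + (a N * v (suc N) i - a (suc N) * v N i))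
    ∎
  where
  open ≡-Reasoning
  S B : ℚ
  S = vSum N (pascal-op a₋ a) i
  B = a 0 * v 1 i - a₋ * v 0 i
  regroup : ∀ S B p a₀ a₁ w w₁ w₋ →
    (S + (B + (p * w - a₀ * w₋))) + a₀ * ((w₁ + ⟦ 2 ⟧ * w) + w₋)
    ≡ (S + (p + ⟦ 2 ⟧ * a₀ + a₁) * w) + (B + (a₀ * w₁ - a₁ * w))
  regroup = RingSolver.solve-∀ ℚ-ring

x-vSum-vanishing : ∀ a₋ a N → prev a₋ a N ≡ 0ℚ → a N ≡ 0ℚ →
                   xMul (vSum N a) ≗ vSum N (pascal-op a₋ a) ⊕ ((a 0 · v 1) ⊖ (a₋ · v 0))
x-vSum-vanishing a₋ a N prev≡0 aN≡0 i = trans (x-vSum a₋ a N i)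
  (trans (cong₂ (λ p q → S + (B + (p * v N i - q * prev (v 1) v N i))) prev≡0 aN≡0)
         (drop S B (v N i) (prev (v 1) v N i)))
  where
  S B : ℚ
  S = vSum N (pascal-op a₋ a) i
  B = a 0 * v 1 i - a₋ * v 0 i
  drop : ∀ S B w w₋ → S + (B + (0ℚ * w - 0ℚ * w₋)) ≡ S + B
  drop = RingSolver.solve-∀ ℚ-ring

vForm : ℕ → (ℕ → ℚ) → Poly
vForm N a = vSum N a ⊖ const (a 0)

vForm-cong : ∀ N {a b : ℕ → ℚ} → (∀ k → a k ≡ b k) → vForm N a ≗ vForm N b
vForm-cong N a≡b i = cong₂ _-_ (sum-cong N (λ k _ j → cong (_* v k j) (a≡b k)) i)
                               (cong (λ c → const c i) (a≡b 0))

xMul-const : ∀ c → xMul (const c) ≗ c · xMul 𝟙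
xMul-const c i = trans (xMul-cong (const-scale c) i) (xMul-· c 𝟙 i)

-- On the right-hand side shape, multiplication by x is the Pascal operator up to a
-- constant: it is here that v_0 = 2 and v_1 = x - 2 enter.
x-vForm : ∀ a₋ a N → prev a₋ a N ≡ 0ℚ → a N ≡ 0ℚ →
          vForm N (pascal-op a₋ a) ≗ xMul (vForm N a) ⊕ const (a₋ - a 1)
x-vForm a₋ a N prev≡0 aN≡0 i = sym (begin
  xMul (vSum N a ⊖ const (a 0)) i + const (a₋ - a 1) i
    ≡⟨ cong₂ _+_ (xMul-⊖ (vSum N a) (const (a 0)) i) (const-scale (a₋ - a 1) i) ⟩
  (xMul (vSum N a) i - xMul (const (a 0)) i) + (a₋ - a 1) * O
    ≡⟨ cong₂ (λ p q → (p - q) + (a₋ - a 1) * O) (x-vSum-vanishing a₋ a N prev≡0 aN≡0 i) (xMul-const (a 0) i) ⟩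
  ((S + (a 0 * (X - ⟦ 2 ⟧ * O) - a₋ * v 0 i)) - a 0 * X) + (a₋ - a 1) * O
    ≡⟨ cong (λ w → ((S + (a 0 * (X - ⟦ 2 ⟧ * O) - a₋ * w)) - a 0 * X) + (a₋ - a 1) * O) (const-scale ⟦ 2 ⟧ i) ⟩
  ((S + (a 0 * (X - ⟦ 2 ⟧ * O) - a₋ * (⟦ 2 ⟧ * O))) - a 0 * X) + (a₋ - a 1) * O
    ≡⟨ collect S (a 0) (a 1) a₋ X O ⟩
  S - (a₋ + ⟦ 2 ⟧ * a 0 + a 1) * O
    ≡⟨ cong (S -_) (const-scale (pascal-op a₋ a 0) i) ⟨
  vForm N (pascal-op a₋ a) i
    ∎)
  where
  open ≡-Reasoning
  S X O : ℚ
  S = vSum N (pascal-op a₋ a) i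
  X = xMul 𝟙 i
  O = 𝟙 i
  collect : ∀ S a₀ a₁ a₋ X O →
    ((S + (a₀ * (X - ⟦ 2 ⟧ * O) - a₋ * (⟦ 2 ⟧ * O))) - a₀ * X) + (a₋ - a₁) * O
    ≡ S - (a₋ + ⟦ 2 ⟧ * a₀ + a₁) * O
  collect = RingSolver.solve-∀ ℚ-ring

horner : (ℕ → ℚ) → ℕ → Poly
horner c n = sumBelow n (λ j → mono (n ∸ suc j) (c j))

horner-step : ∀ c n → horner c (suc n) ≗ xMul (horner c n) ⊕ const (c n)
horner-step c n i = cong₂ _+_ (sym shifted) lowest
  where
  raise : ∀ j → j < n → xMul (mono (n ∸ suc j) (c j)) ≗ mono (n ∸ j) (c j)
  raise j j<n k = trans (xMul-mono (n ∸ suc j) (c j) k)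
                        (cong (λ m → mono m (c j) k) (sym (ℕP.+-∸-assoc 1 j<n)))
  shifted : xMul (horner c n) i ≡ sumBelow n (λ j → mono (n ∸ j) (c j)) i
  shifted = trans (xMul-sum n _ i) (sum-cong n raise i)
  lowest : mono (n ∸ n) (c n) i ≡ const (c n) i
  lowest = cong (λ m → mono m (c n) i) (ℕP.n∸n≡0 n)

scale-step : ∀ s p c → s · (xMul p ⊕ const c) ≗ xMul (s · p) ⊕ const (s * c)
scale-step s p c zero    = at-zero s c
  where
  at-zero : ∀ s c → s * (0ℚ + c) ≡ 0ℚ + s * c
  at-zero = RingSolver.solve-∀ ℚ-ring
scale-step s p c (suc i) = elsewhere s (p i)
  where
  elsewhere : ∀ s q → s * (q + 0ℚ) ≡ s * q + 0ℚ
  elsewhere = RingSolver.solve-∀ ℚ-ring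

module Identity (r : ℕ) where
  open Nat using () renaming (_+_ to _+ℕ_; _*_ to _*ℕ_)

  d : ℕ
  d = suc r

  -- a n k = C(2n, n+d+k), the coefficient of v_k on the right-hand side.
  a : ℕ → ℕ → ℚ
  a n k = ⟦ central n (suc (k +ℕ r)) ⟧

  a-vanish : ∀ {n k} → n ≤ k +ℕ r → a n k ≡ 0ℚ
  a-vanish n≤k+r = cong ⟦_⟧ (central-vanish (s≤s n≤k+r))

  -- The Pascal operator, with C(2n, n+d-1) in the role of a_{-1}, takes row n to row n+1.
  a-pascal : ∀ n k → pascal-op ⟦ central n r ⟧ (a n) k ≡ a (suc n) k
  a-pascal n k = begin
    prev ⟦ central n r ⟧ (a n) k + ⟦ 2 ⟧ * a n k + a n (suc k)
      ≡⟨ cong (λ p → p + ⟦ 2 ⟧ * a n k + a n (suc k)) (prev-a k) ⟩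
    ⟦ central n (k +ℕ r) ⟧ + ⟦ 2 ⟧ * ⟦ central n (suc (k +ℕ r)) ⟧ + ⟦ central n (suc (suc (k +ℕ r))) ⟧
      ≡⟨ ⟦⟧-pascal (central n (k +ℕ r)) (central n (suc (k +ℕ r))) (central n (suc (suc (k +ℕ r)))) ⟨
    ⟦ central n (k +ℕ r) +ℕ 2 *ℕ central n (suc (k +ℕ r)) +ℕ central n (suc (suc (k +ℕ r))) ⟧
      ≡⟨ cong ⟦_⟧ (central-pascal n (k +ℕ r)) ⟩
    a (suc n) k
      ∎
    where
    open ≡-Reasoning
    prev-a : ∀ k → prev ⟦ central n r ⟧ (a n) k ≡ ⟦ central n (k +ℕ r) ⟧
    prev-a zero    = refl
    prev-a (suc k) = refl
    ⟦⟧-pascal : ∀ x y z → ⟦ x +ℕ 2 *ℕ y +ℕ z ⟧ ≡ ⟦ x ⟧ + ⟦ 2 ⟧ * ⟦ y ⟧ + ⟦ z ⟧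
    ⟦⟧-pascal x y z = trans (⟦⟧-+ (x +ℕ 2 *ℕ y) z)
      (cong (_+ ⟦ z ⟧) (trans (⟦⟧-+ x (2 *ℕ y)) (cong (λ q → ⟦ x ⟧ + q) (⟦⟧-* 2 y))))

  -- R_n has the shape vForm with any number M > n - d of terms, since a n k = 0 for k > n - d.
  RHS-as-vForm : ∀ n {M} → suc (n ∸ d) ≤ M → RHS n d ≗ vForm M (a n)
  RHS-as-vForm n {M} T≤M i = cong₂ _-_
    (trans (sum-cong (suc (n ∸ d)) (λ k _ j → cong (_* v k j) (coefficient k)) i)
           (sym (sum-stable (λ k → a n k · v k) tail T≤M i)))
    (cong (λ m → const ⟦ (2 *ℕ n) C m ⟧ i) (ℕP.+-comm n d))
    where
    coefficient : ∀ k → ⟦ (2 *ℕ n) C (n +ℕ d +ℕ k) ⟧ ≡ a n k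
    coefficient k = cong (λ m → ⟦ (2 *ℕ n) C m ⟧) (reindex n r k)
      where
      reindex : ∀ n r k → n +ℕ suc r +ℕ k ≡ suc (k +ℕ r) +ℕ n
      reindex = ℕSolver.solve-∀
    tail : ∀ k → suc (n ∸ d) ≤ k → (a n k · v k) ≗ 0P
    tail k T≤k j = trans (cong (_* v k j) (a-vanish n≤k+r)) (ℚP.*-zeroˡ (v k j))
      where
      open ℕP.≤-Reasoning
      n≤k+r : n ≤ k +ℕ r
      n≤k+r = begin
        n                 ≤⟨ ℕP.m≤n+m∸n n d ⟩
        d +ℕ (n ∸ d)      ≡⟨ ℕP.+-suc r (n ∸ d) ⟨
        r +ℕ suc (n ∸ d)  ≤⟨ ℕP.+-monoʳ-≤ r T≤k ⟩
        r +ℕ k            ≡⟨ ℕP.+-comm r k ⟩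
        k +ℕ r            ∎

  RHS-step : ∀ n → RHS (suc n) d ≗ xMul (RHS n d) ⊕ const (⟦ central n r ⟧ - a n 1)
  RHS-step n = begin
    RHS (suc n) d
      ≈⟨ RHS-as-vForm (suc n) (s≤s (ℕP.m∸n≤m n r)) ⟩
    vForm (suc n) (a (suc n))
      ≈⟨ vForm-cong (suc n) (λ k → sym (a-pascal n k)) ⟩
    vForm (suc n) (pascal-op ⟦ central n r ⟧ (a n))
      ≈⟨ x-vForm ⟦ central n r ⟧ (a n) (suc n) (a-vanish (ℕP.m≤m+n n r))
                 (a-vanish (ℕP.≤-trans (ℕP.n≤1+n n) (ℕP.m≤m+n (suc n) r))) ⟩
    xMul (vForm (suc n) (a n)) ⊕ const (⟦ central n r ⟧ - a n 1)
      ≈⟨ (λ i → cong (_+ const (⟦ central n r ⟧ - a n 1) i)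
                     (xMul-cong (RHS-as-vForm n (s≤s (ℕP.m∸n≤m n d))) i)) ⟨
    xMul (RHS n d) ⊕ const (⟦ central n r ⟧ - a n 1)
      ∎
    where open import Relation.Binary.Reasoning.Setoid (ℕ →-setoid ℚ)

  -- c_j = C(2(j+1), j+1+d)/(j+1), so that L_n = d·horner c n.
  coef : ℕ → ℚ
  coef j = (+ ((2 *ℕ suc j) C (suc j +ℕ d))) Q./ suc j

  LHS-step : ∀ n → LHS (suc n) d ≗ xMul (LHS n d) ⊕ const (⟦ d ⟧ * coef n)
  LHS-step n i = trans (cong (⟦ d ⟧ *_) (horner-step coef n i)) (scale-step ⟦ d ⟧ (horner coef n) (coef n) i)

  coef-key : ∀ n → ⟦ d ⟧ * coef n ≡ ⟦ central n r ⟧ - a n 1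
  coef-key n = trans (cong (λ m → ⟦ d ⟧ * ((+ ((2 *ℕ suc n) C m)) Q./ suc n)) (ℕP.+-comm (suc n) d))
    (quotient-law n d (central (suc n) d) (central n r) (central n (suc (suc r))) (central-quotient n r))

  -- R_0 = C(0,d)·v_0 - C(0,d) = 0.
  RHS-zero : RHS 0 d ≗ 0P
  RHS-zero zero    = refl
  RHS-zero (suc i) = refl

  identity : ∀ n → LHS n d ≗ RHS n d
  identity zero    i = trans (ℚP.*-zeroʳ ⟦ d ⟧) (sym (RHS-zero i))
  identity (suc n) = begin
    LHS (suc n) d
      ≈⟨ LHS-step n ⟩
    xMul (LHS n d) ⊕ const (⟦ d ⟧ * coef n)
      ≈⟨ (λ i → cong₂ _+_ (xMul-cong (identity n) i) (cong (λ c → const c i) (coef-key n))) ⟩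
    xMul (RHS n d) ⊕ const (⟦ central n r ⟧ - a n 1)
      ≈⟨ RHS-step n ⟨
    RHS (suc n) d
      ∎
    where open import Relation.Binary.Reasoning.Setoid (ℕ →-setoid ℚ)

theorem3p1 : (n d : ℕ) → 0 < d → d ≤ n → (i : ℕ) → LHS n d i ≡ RHS n d i
theorem3p1 n (suc r) _ _ = Identity.identity r n
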